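{- Let $q\ge2$. If $f$ is a $q$-quasiadditive function, then $f(0)=0$ and $f(qa)=f(a)$ for all nonnegative integers $a$. If $f$ is a $q$-quasimultiplicative function, then $f(0)=1$ unless $f$ is identically $0$, and $f(qa)=f(a)$ for all nonnegative integers $a$.
   Context: An arithmetic function $f$ (defined on the nonnegative integers) is $q$-quasiadditive if there is a nonnegative integer $r$ such that $f(q^{k+r}a+b)=f(a)+f(b)$ for all nonnegative integers $a,b,k$ with $0\le b<q^k$; it is $q$-quasimultiplicative if there is a nonnegative integer $r$ such that $f(q^{k+r}a+b)=f(a)f(b)$ for all nonnegative integers $a,b,k$ with $0\le b<q^k$. -}

module Defs where

open import Level using (Level)
open import Data.Nat using (ℕ; _+_; _^_; _<_)
open import Data.Nat as ℕ using ()
open import Data.Sum using (_⊎_)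
open import Data.Product using (∃)
open import Algebra.Bundles using (AbelianGroup; CommutativeRing)

IsQuasiadditive : ∀ {c ℓ} (G : AbelianGroup c ℓ) → ℕ → (ℕ → AbelianGroup.Carrier G) → Set ℓ
IsQuasiadditive G q f = ∃ λ (r : ℕ) → ∀ (a b k : ℕ) → b < q ^ k →
  f (q ^ (k + r) ℕ.* a + b) ≈ f a ∙ f b
  where open AbelianGroup G using (_≈_; _∙_)

IsQuasimultiplicative : ∀ {c ℓ} (R : CommutativeRing c ℓ) → ℕ → (ℕ → CommutativeRing.Carrier R) → Set ℓ
IsQuasimultiplicative R q f = ∃ λ (r : ℕ) → ∀ (a b k : ℕ) → b < q ^ k →
  f (q ^ (k + r) ℕ.* a + b) ≈ f a *ᴿ f b
  where open CommutativeRing R using (_≈_) renaming (_*_ to _*ᴿ_)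

-- R has no zero divisors (integral-domain condition, as for ℝ or ℂ).
NoZeroDivisors : ∀ {c ℓ} (R : CommutativeRing c ℓ) → Set (c Level.⊔ ℓ)
NoZeroDivisors R = ∀ x y → x * y ≈ 0# → x ≈ 0# ⊎ y ≈ 0#
  where open CommutativeRing R using (_≈_; _*_; 0#)

-- Both notions are instances of f (q^(k+r) a + b) = f a ∙ f b for a binary operation ∙.
-- Taking a = b = k = 0 shows that f 0 is idempotent, and comparing a = q a', k = 0 with
-- a = a', k = 1 (both with b = 0) gives f (q a) ∙ f 0 = f a ∙ f 0.  In a group the only
-- idempotent is ε; in a ring without zero divisors it is 0 or 1, and f 0 = 0 kills f
-- because f n = f 0 · f n whenever n < q^k.
module Submission where

open import Defs
open import Data.Nat using (ℕ; zero; suc; _+_; _*_; _^_; _≤_; _<_; z<s)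
import Data.Nat.Properties as ℕ
open import Data.Product using (_×_; _,_; ∃; proj₁; proj₂)
open import Data.Sum using (_⊎_; inj₁; inj₂)
import Data.Sum as Sum
open import Algebra.Bundles using (Magma; AbelianGroup; CommutativeRing)
import Relation.Binary.PropositionalEquality as ≡
import Algebra.Definitions as Definitions
import Algebra.Properties.AbelianGroup as AbelianGroupProperties
import Algebra.Properties.Ring as RingProperties
import Relation.Binary.Reasoning.Setoid as SetoidReasoning

n<q^n : ∀ {q} → 2 ≤ q → ∀ n → n < q ^ n
n<q^n 2≤q zero = z<s
n<q^n {q} 2≤q (suc n) = begin-strict
  suc n           ≤⟨ n<q^n 2≤q n ⟩
  q ^ n           <⟨ ℕ.m<m+n (q ^ n) (ℕ.≤-trans z<s (n<q^n 2≤q n)) ⟩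
  q ^ n + q ^ n   ≡⟨ ≡.cong (q ^ n +_) (ℕ.+-identityʳ (q ^ n)) ⟨
  2 * q ^ n       ≤⟨ ℕ.*-monoˡ-≤ (q ^ n) 2≤q ⟩
  q * q ^ n       ∎
  where open ℕ.≤-Reasoning

q^[1+r]*a≡q^r*[q*a] : ∀ q r a → q ^ (1 + r) * a ≡.≡ q ^ r * (q * a)
q^[1+r]*a≡q^r*[q*a] q r a = begin
  q * q ^ r * a     ≡⟨ ≡.cong (_* a) (ℕ.*-comm q (q ^ r)) ⟩
  q ^ r * q * a     ≡⟨ ℕ.*-assoc (q ^ r) q a ⟩
  q ^ r * (q * a)   ∎
  where open ≡.≡-Reasoning

IsQuasihomomorphism : ∀ {c ℓ} (M : Magma c ℓ) → ℕ → (ℕ → Magma.Carrier M) → Set ℓ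
IsQuasihomomorphism M q f = ∃ λ (r : ℕ) → ∀ (a b k : ℕ) → b < q ^ k →
  f (q ^ (k + r) * a + b) ≈ f a ∙ f b
  where open Magma M using (_≈_; _∙_)

module QuasihomomorphismProperties {c ℓ} (M : Magma c ℓ) {q : ℕ} {f : ℕ → Magma.Carrier M}
                                   (quasi : IsQuasihomomorphism M q f) where

  open Magma M
  open Definitions _≈_ using (LeftZero; RightIdentity)
  open SetoidReasoning setoid

  private
    r : ℕ
    r = proj₁ quasi

    split : ∀ a b k → b < q ^ k → f (q ^ (k + r) * a + b) ≈ f a ∙ f b
    split = proj₂ quasi

    split₀ : ∀ k a → 0 < q ^ k → f (q ^ (k + r) * a) ≈ f a ∙ f 0
    split₀ k a 0<q^k = begin
      f (q ^ (k + r) * a)       ≡⟨ ≡.cong f (ℕ.+-identityʳ _) ⟨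
      f (q ^ (k + r) * a + 0)   ≈⟨ split a 0 k 0<q^k ⟩
      f a ∙ f 0                 ∎

  f0-idempotent : f 0 ∙ f 0 ≈ f 0
  f0-idempotent = begin
    f 0 ∙ f 0         ≈⟨ split₀ 0 0 z<s ⟨
    f (q ^ r * 0)     ≡⟨ ≡.cong f (ℕ.*-zeroʳ (q ^ r)) ⟩
    f 0               ∎

  f[q*a]∙f0≈f[a]∙f0 : 0 < q → ∀ a → f (q * a) ∙ f 0 ≈ f a ∙ f 0
  f[q*a]∙f0≈f[a]∙f0 0<q a = begin
    f (q * a) ∙ f 0           ≈⟨ split₀ 0 (q * a) z<s ⟨
    f (q ^ r * (q * a))       ≡⟨ ≡.cong f (q^[1+r]*a≡q^r*[q*a] q r a) ⟨
    f (q ^ (1 + r) * a)       ≈⟨ split₀ 1 a (≡.subst (0 <_) (≡.sym (ℕ.^-identityʳ q)) 0<q) ⟩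
    f a ∙ f 0                 ∎

  f[q*a]≈f[a] : 0 < q → RightIdentity (f 0) _∙_ → ∀ a → f (q * a) ≈ f a
  f[q*a]≈f[a] 0<q f0-identityʳ a = begin
    f (q * a)         ≈⟨ f0-identityʳ (f (q * a)) ⟨
    f (q * a) ∙ f 0   ≈⟨ f[q*a]∙f0≈f[a]∙f0 0<q a ⟩
    f a ∙ f 0         ≈⟨ f0-identityʳ (f a) ⟩
    f a               ∎

  f[n]≈f0∙f[n] : 2 ≤ q → ∀ n → f n ≈ f 0 ∙ f n
  f[n]≈f0∙f[n] 2≤q n = begin
    f n                       ≡⟨ ≡.cong (λ m → f (m + n)) (ℕ.*-zeroʳ (q ^ (n + r))) ⟨
    f (q ^ (n + r) * 0 + n)   ≈⟨ split 0 n n (n<q^n 2≤q n) ⟩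
    f 0 ∙ f n                 ∎

  f≈f0 : 2 ≤ q → LeftZero (f 0) _∙_ → ∀ n → f n ≈ f 0
  f≈f0 2≤q f0-zeroˡ n = trans (f[n]≈f0∙f[n] 2≤q n) (f0-zeroˡ (f n))

module _ {c ℓ} (R : CommutativeRing c ℓ) where

  open CommutativeRing R renaming (_*_ to _·_)
  open RingProperties ring using (x[y-z]≈xy-xz)
  open AbelianGroupProperties +-abelianGroup using (x∙y⁻¹≈ε⇒x≈y)
  open SetoidReasoning setoid

  idempotent⇒≈0⊎≈1 : NoZeroDivisors R → ∀ {x} → x · x ≈ x → x ≈ 0# ⊎ x ≈ 1#
  idempotent⇒≈0⊎≈1 noZeroDivisors {x} x·x≈x =
    Sum.map₂ (x∙y⁻¹≈ε⇒x≈y x 1#) (noZeroDivisors x (x - 1#) x·[x-1]≈0)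
    where
    x·[x-1]≈0 : x · (x - 1#) ≈ 0#
    x·[x-1]≈0 = begin
      x · (x - 1#)      ≈⟨ x[y-z]≈xy-xz x x 1# ⟩
      x · x - x · 1#    ≈⟨ +-cong x·x≈x (-‿cong (*-identityʳ x)) ⟩
      x - x             ≈⟨ -‿inverseʳ x ⟩
      0#                ∎

module QuasiadditiveProperties {c ℓ} (G : AbelianGroup c ℓ) {q : ℕ}
                               {f : ℕ → AbelianGroup.Carrier G}
                               (quasi : IsQuasiadditive G q f) where

  open AbelianGroup G
  open AbelianGroupProperties G using (identityˡ-unique)
  private module Q = QuasihomomorphismProperties magma quasi

  f0≈ε : f 0 ≈ ε
  f0≈ε = identityˡ-unique (f 0) (f 0) Q.f0-idempotent

  f[q*a]≈f[a] : 0 < q → ∀ a → f (q * a) ≈ f a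
  f[q*a]≈f[a] 0<q = Q.f[q*a]≈f[a] 0<q (λ x → trans (∙-congˡ f0≈ε) (identityʳ x))

module QuasimultiplicativeProperties {c ℓ} (R : CommutativeRing c ℓ)
                                     (noZeroDivisors : NoZeroDivisors R) {q : ℕ}
                                     {f : ℕ → CommutativeRing.Carrier R}
                                     (quasi : IsQuasimultiplicative R q f) where

  open CommutativeRing R renaming (_*_ to _·_)
  private module Q = QuasihomomorphismProperties *-magma quasi

  f0≈1⊎f≈0 : 2 ≤ q → f 0 ≈ 1# ⊎ (∀ n → f n ≈ 0#)
  f0≈1⊎f≈0 2≤q with idempotent⇒≈0⊎≈1 R noZeroDivisors Q.f0-idempotent
  ... | inj₂ f0≈1 = inj₁ f0≈1
  ... | inj₁ f0≈0 = inj₂ (λ n → trans (Q.f≈f0 2≤q f0-zeroˡ n) f0≈0)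
    where
    f0-zeroˡ : ∀ x → f 0 · x ≈ f 0
    f0-zeroˡ x = trans (*-congʳ f0≈0) (trans (zeroˡ x) (sym f0≈0))

  f[q*a]≈f[a] : 2 ≤ q → ∀ a → f (q * a) ≈ f a
  f[q*a]≈f[a] 2≤q a with f0≈1⊎f≈0 2≤q
  ... | inj₁ f0≈1 =
    Q.f[q*a]≈f[a] (ℕ.≤-trans (z<s {1}) 2≤q) (λ x → trans (*-congˡ f0≈1) (*-identityʳ x)) a
  ... | inj₂ f≈0  = trans (f≈0 (q * a)) (sym (f≈0 a))

mainTheorem9 : ∀ {c ℓ} (q : ℕ) → 2 ≤ q →
    (∀ (G : AbelianGroup c ℓ) (f : ℕ → AbelianGroup.Carrier G) →
    IsQuasiadditive G q f →
    AbelianGroup._≈_ G (f 0) (AbelianGroup.ε G)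
    × (∀ (a : ℕ) → AbelianGroup._≈_ G (f (q * a)) (f a)))
    × (∀ (R : CommutativeRing c ℓ) → NoZeroDivisors R →
    (f : ℕ → CommutativeRing.Carrier R) →
    IsQuasimultiplicative R q f →
    (CommutativeRing._≈_ R (f 0) (CommutativeRing.1# R)
    ⊎ (∀ (n : ℕ) → CommutativeRing._≈_ R (f n) (CommutativeRing.0# R)))
    × (∀ (a : ℕ) → CommutativeRing._≈_ R (f (q * a)) (f a)))
mainTheorem9 q 2≤q =
  (λ G f quasi → let open QuasiadditiveProperties G quasi in
     f0≈ε , f[q*a]≈f[a] (ℕ.≤-trans (z<s {1}) 2≤q))
  , (λ R noZeroDivisors f quasi → let open QuasimultiplicativeProperties R noZeroDivisors quasi in
     f0≈1⊎f≈0 2≤q , f[q*a]≈f[a] 2≤q)
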